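{- Let $n\ge1$, $0\le k\le n$, $d=\gcd(n,k)$, and let $R_i$ and $C_j$ ($0\le i,j\le n-1$) denote the rows and columns of the cyclic $(n,k)$-matrix $M_{n,k}$. Then (i) $R_i=R_j$ if and only if $i\equiv j\pmod{n/d}$; (ii) $C_i=C_j$ if and only if $dq\le i,j\le d(q+1)-1$ for some $q\in\{0,1,\dots,\tfrac{n}{d}-1\}$.
   Context: The cyclic $(n,k)$-matrix is $M_{n,k}=(m_{i,j})_{0\le i,j\le n-1}$ with $m_{i,j}=1$ iff $j\equiv ik+a\pmod n$ for some $0\le a\le k-1$, and $m_{i,j}=0$ otherwise. -}

module Defs where

open import Data.Nat using (ℕ; zero; suc; _+_; _*_; _<_; _%_)
open import Data.Nat.GCD using (gcd; gcd[m,n]∣m)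
open import Data.Nat.Divisibility using (_∣_; quotient)
open import Data.Bool using (Bool; true; false; _∨_)
open import Data.Product using (∃)
open import Data.Sum using (_⊎_)
open import Relation.Binary.PropositionalEquality using (_≡_)
open import Relation.Nullary using (does)
open import Data.Nat using (_≟_)

-- Entry m_{i,j} of the cyclic (n,k)-matrix, for n = suc n' ≥ 1 and 0 ≤ i,j ≤ n-1:
-- m_{i,j} = 1 (true) iff j ≡ i*k + a (mod n) for some 0 ≤ a ≤ k-1.
-- anyBelow k P = P 0 ∨ … ∨ P (k-1).
anyBelow : ℕ → (ℕ → Bool) → Bool
anyBelow zero    P = false
anyBelow (suc a) P = anyBelow a P ∨ P a

cyclicEntry : (n' k i j : ℕ) → Bool
cyclicEntry n' k i j = anyBelow k (λ a → does (((i * k + a) % suc n') ≟ (j % suc n')))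

RowsEq : (n' k i i' : ℕ) → Set
RowsEq n' k i i' = ∀ j → j < suc n' → cyclicEntry n' k i j ≡ cyclicEntry n' k i' j

ColsEq : (n' k j j' : ℕ) → Set
ColsEq n' k j j' = ∀ i → i < suc n' → cyclicEntry n' k i j ≡ cyclicEntry n' k i j'

nOverD : (n k : ℕ) → ℕ
nOverD n k = quotient (gcd[m,n]∣m n k)

ModEq : (p a b : ℕ) → Set
ModEq p a b = ∃ λ t → (a + t * p ≡ b) ⊎ (b + t * p ≡ a)

-- Row i of M_{n,k} is the indicator of the cyclic window [ik, ik + k) of ℤ/n. Writing n = md and
-- k = Kd with gcd(m, K) = 1, such a window is a union of blocks of d consecutive columns, so M_{n,k}
-- is M_{m,K} with every column repeated d times: entry (i, j) depends only on iK mod m and on j / d.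
-- When 0 < K < m, a window of length K in ℤ/m determines its starting point, and a point of ℤ/m is
-- determined by the windows containing it. As K is a unit mod m, iK ≡ i′K (mod m) iff i ≡ i′ (mod m),
-- and every residue occurs as some iK; this gives (i) and (ii). If K = 0 or K = m, then m = 1.
module Submission where

open import Defs
open import Data.Nat using (ℕ; suc; _+_; _*_; _≤_; _<_)
open import Data.Nat.GCD using (gcd)
open import Data.Product using (_×_; ∃)
open import Function.Bundles using (_⇔_)
open import Data.Nat using (zero; pred; _∸_; _%_; _/_; NonZero; >-nonZero⁻¹; ≢-nonZero; _≟_; _≤?_)
open import Data.Nat.Properties
open import Data.Nat.DivMod
open import Data.Nat.Divisibility using (_∣_; m∣m*n; quotient; quotient≢0; n/m≡quotient; ∣-refl; ∣-reflexive)
open import Data.Nat.GCD using (gcd[m,n]∣m; gcd[m,n]∣n; gcd[m,n]≢0; module Bézout)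
open import Data.Nat.Coprimality using (Coprime; coprime-Bézout; coprime-/gcd; 0-coprimeTo-m⇒m≡1)
  renaming (sym to Coprime-sym)
open import Data.Nat.Tactic.RingSolver using (solve-∀)
open import Data.Bool using (Bool; true; false)
open import Data.Bool.Properties using (⇔→≡)
open import Data.Product using (_,_; proj₁; proj₂)
open import Data.Sum using (_⊎_; inj₁; inj₂)
open import Function.Bundles using (mk⇔; Equivalence)
import Function.Properties.Equivalence as Eq
open import Relation.Nullary using (¬_; Dec; yes; no; does; contradiction)
open import Relation.Binary.PropositionalEquality

open Equivalence using (to; from)

anyBelow-true⇔ : ∀ {P : ℕ → Set} (P? : ∀ a → Dec (P a)) k →
                 anyBelow k (λ a → does (P? a)) ≡ true ⇔ ∃ λ a → a < k × P a
anyBelow-true⇔ P? zero = mk⇔ (λ ()) (λ { (_ , () , _) })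
anyBelow-true⇔ {P} P? (suc k) with anyBelow k (λ a → does (P? a)) in below | P? k
... | true  | _      = mk⇔ (λ _ → weaken (to (anyBelow-true⇔ P? k) below)) (λ _ → refl)
  where weaken : ∃ (λ a → a < k × P a) → ∃ λ a → a < suc k × P a
        weaken (a , a<k , pa) = a , m<n⇒m<1+n a<k , pa
... | false | yes pk = mk⇔ (λ _ → k , ≤-refl , pk) (λ _ → refl)
... | false | no ¬pk = mk⇔ (λ ()) witness⇒⊥
  where
  witness⇒⊥ : ∃ (λ a → a < suc k × P a) → false ≡ true
  witness⇒⊥ (a , a<1+k , pa) with m<1+n⇒m<n∨m≡n a<1+k
  ... | inj₁ a<k  = trans (sym below) (from (anyBelow-true⇔ P? k) (a , a<k , pa))
  ... | inj₂ refl = contradiction pa ¬pk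

-- gap m r j is the e < m with r + e ≡ j (mod m); pred m * r represents −r.
gap : (m : ℕ) .{{_ : NonZero m}} → ℕ → ℕ → ℕ
gap m r j = (j + pred m * r) % m

+-pred*-cancel : ∀ m .{{_ : NonZero m}} r j → r + j + pred m * r ≡ j + r * m
+-pred*-cancel (suc m-1) r j = lemma r j m-1
  where lemma : ∀ r j m-1 → r + j + m-1 * r ≡ j + r * suc m-1
        lemma = solve-∀

module _ {m : ℕ} .{{_ : NonZero m}} where
  open ≡-Reasoning

  %-cong-+ : ∀ {a a′ b b′} → a % m ≡ a′ % m → b % m ≡ b′ % m → (a + b) % m ≡ (a′ + b′) % m
  %-cong-+ {a} {a′} {b} {b′} p q = begin
    (a + b) % m             ≡⟨ %-distribˡ-+ a b m ⟩
    (a % m + b % m) % m     ≡⟨ cong₂ (λ x y → (x + y) % m) p q ⟩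
    (a′ % m + b′ % m) % m   ≡⟨ %-distribˡ-+ a′ b′ m ⟨
    (a′ + b′) % m           ∎

  %-cong-* : ∀ {a a′ b b′} → a % m ≡ a′ % m → b % m ≡ b′ % m → (a * b) % m ≡ (a′ * b′) % m
  %-cong-* {a} {a′} {b} {b′} p q = begin
    (a * b) % m             ≡⟨ %-distribˡ-* a b m ⟩
    (a % m * (b % m)) % m   ≡⟨ cong₂ (λ x y → (x * y) % m) p q ⟩
    (a′ % m * (b′ % m)) % m ≡⟨ %-distribˡ-* a′ b′ m ⟨
    (a′ * b′) % m           ∎

  gap<m : ∀ r j → gap m r j < m
  gap<m r j = m%n<n _ m

  gap≡⇔ : ∀ {r j e} → e < m → gap m r j ≡ e ⇔ (r + e) % m ≡ j % m
  gap≡⇔ {r} {j} {e} e<m = mk⇔ reaches determined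
    where
    reaches : gap m r j ≡ e → (r + e) % m ≡ j % m
    reaches refl = begin
      (r + (j + pred m * r) % m) % m ≡⟨ %-cong-+ {a = r} refl (m%n%n≡m%n _ m) ⟩
      (r + (j + pred m * r)) % m     ≡⟨ cong (_% m) (+-assoc r j _) ⟨
      (r + j + pred m * r) % m       ≡⟨ cong (_% m) (+-pred*-cancel m r j) ⟩
      (j + r * m) % m                ≡⟨ [m+kn]%n≡m%n j r m ⟩
      j % m                          ∎
    determined : (r + e) % m ≡ j % m → gap m r j ≡ e
    determined hit = begin
      (j + pred m * r) % m     ≡⟨ %-cong-+ (sym hit) refl ⟩
      (r + e + pred m * r) % m ≡⟨ cong (_% m) (+-pred*-cancel m r e) ⟩
      (e + r * m) % m          ≡⟨ [m+kn]%n≡m%n e r m ⟩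
      e % m                    ≡⟨ m<n⇒m%n≡m e<m ⟩
      e                        ∎

  pred<m : pred m < m
  pred<m = subst (pred m <_) (suc-pred m) (n<1+n (pred m))

  gap-cong : ∀ {r r′ j j′} → r % m ≡ r′ % m → j % m ≡ j′ % m → gap m r j ≡ gap m r′ j′
  gap-cong p q = %-cong-+ q (%-cong-* {a = pred m} refl p)

  gap-self : ∀ r → gap m r r ≡ 0
  gap-self r = from (gap≡⇔ (>-nonZero⁻¹ m)) (cong (_% m) (+-identityʳ r))

  gap-sucˡ : ∀ {r j e} → gap m r j ≡ suc e → gap m (suc r) j ≡ e
  gap-sucˡ {r} {j} {e} g = from (gap≡⇔ (<-trans (n<1+n e) e+1<m))
    (trans (cong (_% m) (sym (+-suc r e))) (to (gap≡⇔ e+1<m) g))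
    where e+1<m : suc e < m
          e+1<m = subst (_< m) g (gap<m r j)

  gap-predʳ : ∀ {r j e} → gap m r j ≡ suc e → gap m r (j + pred m) ≡ e
  gap-predʳ {r} {j} {e} g = from (gap≡⇔ (<-trans (n<1+n e) e+1<m)) (begin
    (r + e) % m                  ≡⟨ [m+n]%n≡m%n (r + e) m ⟨
    (r + e + m) % m              ≡⟨ cong (_% m) (shift r e) ⟩
    (r + suc e + pred m) % m     ≡⟨ %-cong-+ (to (gap≡⇔ e+1<m) g) refl ⟩
    (j + pred m) % m             ∎)
    where
    e+1<m : suc e < m
    e+1<m = subst (_< m) g (gap<m r j)
    shift : ∀ r e → r + e + m ≡ r + suc e + pred m
    shift r e = begin
      r + e + m            ≡⟨ cong (r + e +_) (suc-pred m) ⟨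
      r + e + suc (pred m) ≡⟨ +-suc (r + e) (pred m) ⟩
      suc (r + e) + pred m ≡⟨ cong (_+ pred m) (+-suc r e) ⟨
      r + suc e + pred m   ∎

  gap-pred-self : ∀ r → gap m r (r + pred m) ≡ pred m
  gap-pred-self r = from (gap≡⇔ pred<m) refl

  gap-suc-self : ∀ j → gap m (suc j) j ≡ pred m
  gap-suc-self j = from (gap≡⇔ pred<m) (begin
    (suc j + pred m) % m   ≡⟨ cong (_% m) (+-suc j (pred m)) ⟨
    (j + suc (pred m)) % m ≡⟨ cong (λ x → (j + x) % m) (suc-pred m) ⟩
    (j + m) % m            ≡⟨ [m+n]%n≡m%n j m ⟩
    j % m                  ∎)

InWindow : (m : ℕ) .{{_ : NonZero m}} → (K r j : ℕ) → Set
InWindow m K r j = gap m r j < K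

module _ {m K : ℕ} .{{_ : NonZero m}} (0<K : 0 < K) (K<m : K < m) where

  private
    start∈ : ∀ r → InWindow m K r r
    start∈ r = subst (_< K) (sym (gap-self r)) 0<K

    last∉ : ∀ {r j} → gap m r j ≡ pred m → ¬ InWindow m K r j
    last∉ g j∈ = <⇒≱ K<m (subst (_≤ K) (suc-pred m) (subst (λ x → suc x ≤ K) g j∈))

    sameResidue : ∀ {r j} → gap m r j ≡ 0 → r % m ≡ j % m
    sameResidue {r} g = trans (cong (_% m) (sym (+-identityʳ r))) (to (gap≡⇔ (>-nonZero⁻¹ m)) g)

  -- If the window at r′ starts e + 1 > 0 steps before r, then r − 1 lies in it but not in the
  -- window at r. Dually, if j′ is e + 1 steps after j, the window at j + 1 contains j′ but not j.
  InWindow-injectiveˡ : ∀ {r r′} → (∀ j → InWindow m K r j ⇔ InWindow m K r′ j) → r % m ≡ r′ % m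
  InWindow-injectiveˡ {r} {r′} same with gap m r′ r in g | to (same r) (start∈ r)
  ... | zero  | _   = sym (sameResidue g)
  ... | suc e | e+1<K = contradiction (from (same (r + pred m)) e∈) (last∉ (gap-pred-self r))
    where e∈ : InWindow m K r′ (r + pred m)
          e∈ = subst (_< K) (sym (gap-predʳ g)) (<-trans (n<1+n e) e+1<K)

  InWindow-injectiveʳ : ∀ {j j′} → (∀ r → InWindow m K r j ⇔ InWindow m K r j′) → j % m ≡ j′ % m
  InWindow-injectiveʳ {j} {j′} same with gap m j j′ in g | to (same j) (start∈ j)
  ... | zero  | _   = sameResidue g
  ... | suc e | e+1<K = contradiction (from (same (suc j)) e∈) (last∉ (gap-suc-self j))
    where e∈ : InWindow m K (suc j) j′
          e∈ = subst (_< K) (sym (gap-sucˡ g)) (<-trans (n<1+n e) e+1<K)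

∃hit⇔InWindow : ∀ {m k r j} .{{_ : NonZero m}} → k ≤ m →
                (∃ λ a → a < k × (r + a) % m ≡ j % m) ⇔ InWindow m k r j
∃hit⇔InWindow {m} {k} {r} {j} k≤m = mk⇔
  (λ { (a , a<k , hit) → subst (_< k) (sym (from (gap≡⇔ (<-≤-trans a<k k≤m)) hit)) a<k })
  (λ j∈ → gap m r j , j∈ , to (gap≡⇔ (gap<m r j)) refl)

cyclicEntry-true⇔ : ∀ {n′ k} i j → k ≤ suc n′ →
                    cyclicEntry n′ k i j ≡ true ⇔ InWindow (suc n′) k (i * k) j
cyclicEntry-true⇔ {n′} {k} i j k≤n =
  Eq.trans (anyBelow-true⇔ (λ a → (i * k + a) % suc n′ ≟ j % suc n′) k)
           (∃hit⇔InWindow {r = i * k} {j} k≤n)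

+-<-*⇔ : ∀ m n {c d} → c < d → m * d + c < n * d ⇔ m < n
+-<-*⇔ m n {c} {d} c<d = mk⇔ cancel bound
  where
  bound : m < n → m * d + c < n * d
  bound m<n = <-≤-trans (+-monoʳ-< (m * d) c<d) (subst (_≤ n * d) (+-comm d (m * d)) (*-monoˡ-≤ d m<n))
  cancel : m * d + c < n * d → m < n
  cancel lt = ≰⇒> λ n≤m → <⇒≱ lt (≤-trans (*-monoˡ-≤ d n≤m) (m≤m+n (m * d) c))

module _ {m d : ℕ} .{{_ : NonZero m}} .{{_ : NonZero d}} .{{_ : NonZero (m * d)}} where
  open ≡-Reasoning

  gap-scale : ∀ r j → gap (m * d) (r * d) j ≡ gap m r (j / d) * d + j % d
  gap-scale r j = from (gap≡⇔ e<md) (begin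
    (r * d + (g * d + c)) % (m * d)   ≡⟨ cong (_% (m * d)) (regroup r g) ⟩
    ((r + g) * d + c) % (m * d)       ≡⟨ [m*n+o]%[p*n]≡[m*n]%[p*n]+o (r + g) m c<d ⟩
    (r + g) * d % (m * d) + c         ≡⟨ cong (_+ c) (m%n*o≡m*o%[n*o] (r + g) m d) ⟨
    (r + g) % m * d + c               ≡⟨ cong (λ x → x * d + c) (to (gap≡⇔ (gap<m r q)) refl) ⟩
    q % m * d + c                     ≡⟨ cong (_+ c) (m%n*o≡m*o%[n*o] q m d) ⟩
    q * d % (m * d) + c               ≡⟨ [m*n+o]%[p*n]≡[m*n]%[p*n]+o q m c<d ⟨
    (q * d + c) % (m * d)             ≡⟨ cong (_% (m * d)) (+-comm (q * d) c) ⟩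
    (c + q * d) % (m * d)             ≡⟨ cong (_% (m * d)) (m≡m%n+[m/n]*n j d) ⟨
    j % (m * d)                       ∎)
    where
    q c g : ℕ
    q = j / d
    c = j % d
    g = gap m r q
    c<d : c < d
    c<d = m%n<n j d
    e<md : g * d + c < m * d
    e<md = from (+-<-*⇔ g m c<d) (gap<m r q)
    regroup : ∀ r g → r * d + (g * d + c) ≡ (r + g) * d + c
    regroup r g = trans (sym (+-assoc (r * d) (g * d) c)) (cong (_+ c) (sym (*-distribʳ-+ d r g)))

InWindow-blowup : ∀ {n m d k K} .{{_ : NonZero n}} .{{_ : NonZero m}} .{{_ : NonZero d}} →
                  n ≡ m * d → k ≡ K * d → ∀ r j → InWindow n k (r * d) j ⇔ InWindow m K r (j / d)
InWindow-blowup {m = m} {d} {K = K} refl refl r j =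
  subst (λ x → x < K * d ⇔ InWindow m K r (j / d)) (sym (gap-scale r j))
        (+-<-*⇔ (gap m r (j / d)) K (m%n<n j d))

+-pred-inverse : ∀ m .{{_ : NonZero m}} y K x → 1 + y * K ≡ x * m → y * pred m * K + x * m ≡ 1 + y * K * m
+-pred-inverse (suc p) y K x eq = begin
  y * p * K + x * suc p       ≡⟨ cong (y * p * K +_) eq ⟨
  y * p * K + (1 + y * K)     ≡⟨ lemma y p K ⟩
  1 + y * K * suc p           ∎
  where open ≡-Reasoning
        lemma : ∀ y p K → y * p * K + (1 + y * K) ≡ 1 + y * K * suc p
        lemma = solve-∀

module _ {m K : ℕ} .{{_ : NonZero m}} (m⊥K : Coprime m K) where
  open ≡-Reasoning

  inverse-mod : ∃ λ u → u * K % m ≡ 1 % m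
  inverse-mod with coprime-Bézout m⊥K
  ... | Bézout.-+ x y eq = y , trans (cong (_% m) (sym eq)) ([m+kn]%n≡m%n 1 x m)
  -- Here yK ≡ −1 (mod m), so y · pred m is the inverse.
  ... | Bézout.+- x y eq = y * pred m , (begin
    y * pred m * K % m               ≡⟨ [m+kn]%n≡m%n _ x m ⟨
    (y * pred m * K + x * m) % m     ≡⟨ cong (_% m) (+-pred-inverse m y K x eq) ⟩
    (1 + y * K * m) % m              ≡⟨ [m+kn]%n≡m%n 1 (y * K) m ⟩
    1 % m                            ∎)

  *-cancelʳ-% : ∀ i i′ → i * K % m ≡ i′ * K % m → i % m ≡ i′ % m
  *-cancelʳ-% i i′ h = begin
    i % m                ≡⟨ undo i ⟨
    i * K * u % m        ≡⟨ %-cong-* h refl ⟩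
    i′ * K * u % m       ≡⟨ undo i′ ⟩
    i′ % m               ∎
    where
    u : ℕ
    u = proj₁ inverse-mod
    undo : ∀ x → x * K * u % m ≡ x % m
    undo x = begin
      x * K * u % m      ≡⟨ cong (_% m) (trans (*-assoc x K u) (cong (x *_) (*-comm K u))) ⟩
      x * (u * K) % m    ≡⟨ %-cong-* {a = x} refl (proj₂ inverse-mod) ⟩
      x * 1 % m          ≡⟨ cong (_% m) (*-identityʳ x) ⟩
      x % m              ∎

  *-%-surjective : ∀ s → ∃ λ i → i < m × i * K % m ≡ s % m
  *-%-surjective s = s * u % m , m%n<n _ m , (begin
    s * u % m * K % m    ≡⟨ %-cong-* (m%n%n≡m%n _ m) refl ⟩
    s * u * K % m        ≡⟨ cong (_% m) (*-assoc s u K) ⟩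
    s * (u * K) % m      ≡⟨ %-cong-* {a = s} refl (proj₂ inverse-mod) ⟩
    s * 1 % m            ≡⟨ cong (_% m) (*-identityʳ s) ⟩
    s % m                ∎)
    where u : ℕ
          u = proj₁ inverse-mod

%≡%⇔ModEq : ∀ {m} .{{_ : NonZero m}} {a b} → a % m ≡ b % m ⇔ ModEq m a b
%≡%⇔ModEq {m} {a} {b} = mk⇔ difference residue
  where
  open ≡-Reasoning
  stepUp : ∀ {x y} → x ≤ y → x % m ≡ y % m → x + (y / m ∸ x / m) * m ≡ y
  stepUp {x} {y} x≤y h = begin
    x + (y / m ∸ x / m) * m                   ≡⟨ cong (_+ (y / m ∸ x / m) * m) (m≡m%n+[m/n]*n x m) ⟩
    x % m + x / m * m + (y / m ∸ x / m) * m   ≡⟨ +-assoc (x % m) _ _ ⟩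
    x % m + (x / m * m + (y / m ∸ x / m) * m) ≡⟨ cong (x % m +_) (*-distribʳ-+ m (x / m) _) ⟨
    x % m + (x / m + (y / m ∸ x / m)) * m     ≡⟨ cong (λ t → x % m + t * m) (m+[n∸m]≡n (/-monoˡ-≤ m x≤y)) ⟩
    x % m + y / m * m                         ≡⟨ cong (_+ y / m * m) h ⟩
    y % m + y / m * m                         ≡⟨ m≡m%n+[m/n]*n y m ⟨
    y                                         ∎
  difference : a % m ≡ b % m → ModEq m a b
  difference h with ≤-total a b
  ... | inj₁ a≤b = b / m ∸ a / m , inj₁ (stepUp a≤b h)
  ... | inj₂ b≤a = a / m ∸ b / m , inj₂ (stepUp b≤a (sym h))
  residue : ModEq m a b → a % m ≡ b % m
  residue (t , inj₁ refl) = sym ([m+kn]%n≡m%n a t m)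
  residue (t , inj₂ refl) = [m+kn]%n≡m%n b t m

/≡⇔block : ∀ {d} .{{_ : NonZero d}} {j q} → j / d ≡ q ⇔ (d * q ≤ j × suc j ≤ d * suc q)
/≡⇔block {d} {j} {q} = mk⇔ bounds divide
  where
  open ≡-Reasoning
  bounds : j / d ≡ q → d * q ≤ j × suc j ≤ d * suc q
  bounds refl = subst (_≤ j) (*-comm (j / d) d) (m/n*n≤m j d)
              , subst (suc j ≤_) (sym (trans (*-suc d (j / d)) (cong (d +_) (*-comm d (j / d)))))
                  (subst (λ x → suc x ≤ d + j / d * d) (sym (m≡m%n+[m/n]*n j d))
                    (+-monoˡ-≤ (j / d * d) (m%n<n j d)))
  divide : d * q ≤ j × suc j ≤ d * suc q → j / d ≡ q
  divide (dq≤j , j<d[q+1]) = begin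
    j / d                     ≡⟨ cong (_/ d) (m+[n∸m]≡n dq≤j) ⟨
    (d * q + c) / d           ≡⟨ +-distrib-/-∣ˡ c (m∣m*n q) ⟩
    d * q / d + c / d         ≡⟨ cong₂ _+_ (trans (cong (_/ d) (*-comm d q)) (m*n/n≡m q d)) (m<n⇒m/n≡0 c<d) ⟩
    q + 0                     ≡⟨ +-identityʳ q ⟩
    q                         ∎
    where
    c : ℕ
    c = j ∸ d * q
    c<d : c < d
    c<d = +-cancelˡ-< (d * q) c d
            (subst₂ _<_ (sym (m+[n∸m]≡n dq≤j)) (trans (*-suc d q) (+-comm d (d * q))) j<d[q+1])

≡⇔[≡true⇔] : ∀ {b b′ : Bool} → b ≡ b′ ⇔ (b ≡ true ⇔ b′ ≡ true)
≡⇔[≡true⇔] = mk⇔ (λ { refl → Eq.refl }) ⇔→≡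

InWindow-cong : ∀ {m K r r′ j j′} .{{_ : NonZero m}} → r % m ≡ r′ % m → j % m ≡ j′ % m →
                InWindow m K r j ⇔ InWindow m K r′ j′
InWindow-cong {K = K} {r} {j = j} p q = subst (λ g → InWindow _ K r j ⇔ g < K) (gap-cong p q) Eq.refl

m≤1⇒x%m≡y%m : ∀ {m} .{{_ : NonZero m}} → m ≤ 1 → ∀ x y → x % m ≡ y % m
m≤1⇒x%m≡y%m {m} m≤1 x y = trans (residue x) (sym (residue y))
  where residue : ∀ x → x % m ≡ 0
        residue x = n<1⇒n≡0 (<-≤-trans (m%n<n x m) m≤1)

module CyclicMatrix {n′ k : ℕ} (k≤n : k ≤ suc n′) {m d K : ℕ} .{{_ : NonZero m}} .{{_ : NonZero d}}
                    (n≡m*d : suc n′ ≡ m * d) (k≡K*d : k ≡ K * d) (m⊥K : Coprime m K) where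

  n : ℕ
  n = suc n′

  m≤n : m ≤ n
  m≤n = subst (m ≤_) (sym n≡m*d) (m≤m*n m d)

  m≤1⊎0<K<m : m ≤ 1 ⊎ (0 < K × K < m)
  m≤1⊎0<K<m with m ≤? 1
  ... | yes m≤1 = inj₁ m≤1
  ... | no m≰1 = inj₂ (n≢0⇒n>0 K≢0 , ≤∧≢⇒< K≤m K≢m)
    where
    m≢1 : m ≢ 1
    m≢1 e = m≰1 (≤-reflexive e)
    K≢0 : K ≢ 0
    K≢0 e = m≢1 (0-coprimeTo-m⇒m≡1 (Coprime-sym (subst (Coprime m) e m⊥K)))
    K≢m : K ≢ m
    K≢m e = m≢1 (m⊥K (∣-refl , ∣-reflexive (sym e)))
    K≤m : K ≤ m
    K≤m = *-cancelʳ-≤ K m d (subst₂ _≤_ k≡K*d n≡m*d k≤n)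

  entry-true⇔ : ∀ i j → cyclicEntry n′ k i j ≡ true ⇔ InWindow m K (i * K) (j / d)
  entry-true⇔ i j = Eq.trans (cyclicEntry-true⇔ i j k≤n)
    (subst (λ r → InWindow n k r j ⇔ InWindow m K (i * K) (j / d)) (sym ik≡iKd)
      (InWindow-blowup n≡m*d k≡K*d (i * K) j))
    where ik≡iKd : i * k ≡ i * K * d
          ik≡iKd = trans (cong (i *_) k≡K*d) (sym (*-assoc i K d))

  entries≡⇔ : ∀ i j i′ j′ → cyclicEntry n′ k i j ≡ cyclicEntry n′ k i′ j′ ⇔
              (InWindow m K (i * K) (j / d) ⇔ InWindow m K (i′ * K) (j′ / d))
  entries≡⇔ i j i′ j′ = mk⇔
    (λ e → Eq.trans (Eq.sym (entry-true⇔ i j)) (Eq.trans (to ≡⇔[≡true⇔] e) (entry-true⇔ i′ j′)))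
    (λ w → from ≡⇔[≡true⇔] (Eq.trans (entry-true⇔ i j) (Eq.trans w (Eq.sym (entry-true⇔ i′ j′)))))

  window-start-unique : ∀ {r r′} → (∀ j → InWindow m K r j ⇔ InWindow m K r′ j) → r % m ≡ r′ % m
  window-start-unique {r} {r′} same with m≤1⊎0<K<m
  ... | inj₁ m≤1          = m≤1⇒x%m≡y%m m≤1 r r′
  ... | inj₂ (0<K , K<m)  = InWindow-injectiveˡ 0<K K<m same

  window-point-unique : ∀ {j j′} → (∀ r → InWindow m K r j ⇔ InWindow m K r j′) → j % m ≡ j′ % m
  window-point-unique {j} {j′} same with m≤1⊎0<K<m
  ... | inj₁ m≤1          = m≤1⇒x%m≡y%m m≤1 j j′
  ... | inj₂ (0<K , K<m)  = InWindow-injectiveʳ 0<K K<m same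

  rowsEq⇔ : ∀ i i′ → RowsEq n′ k i i′ ⇔ i * K % m ≡ i′ * K % m
  rowsEq⇔ i i′ = mk⇔ (λ R → window-start-unique (sameWindow R))
                      (λ e j _ → from (entries≡⇔ i j i′ j) (InWindow-cong e refl))
    where
    sameWindow : RowsEq n′ k i i′ → ∀ q → InWindow m K (i * K) q ⇔ InWindow m K (i′ * K) q
    sameWindow R q = Eq.trans (InWindow-cong refl (sym q%m≡))
                       (Eq.trans (to (entries≡⇔ i j i′ j) (R j j<n)) (InWindow-cong refl q%m≡))
      where
      j : ℕ
      j = q % m * d
      j<n : j < n
      j<n = subst (j <_) (sym n≡m*d) (*-monoˡ-< d (m%n<n q m))
      q%m≡ : j / d % m ≡ q % m
      q%m≡ = trans (cong (_% m) (m*n/n≡m (q % m) d)) (m%n%n≡m%n q m)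

  colsEq⇔ : ∀ j j′ → j < n → j′ < n → ColsEq n′ k j j′ ⇔ j / d ≡ j′ / d
  colsEq⇔ j j′ j<n j′<n = mk⇔
    (λ C → trans (sym (block<m j<n)) (trans (window-point-unique (sameWindows C)) (block<m j′<n)))
    (λ e i _ → from (entries≡⇔ i j i j′)
                 (subst (λ q → InWindow m K (i * K) (j / d) ⇔ InWindow m K (i * K) q) e Eq.refl))
    where
    block<m : ∀ {x} → x < n → x / d % m ≡ x / d
    block<m {x} x<n = m<n⇒m%n≡m (m<n*o⇒m/o<n {x} {m} {d} (subst (x <_) n≡m*d x<n))
    sameWindows : ColsEq n′ k j j′ → ∀ s → InWindow m K s (j / d) ⇔ InWindow m K s (j′ / d)
    sameWindows C s with *-%-surjective m⊥K s
    ... | i , i<m , iK≡s =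
      Eq.trans (InWindow-cong (sym iK≡s) refl)
        (Eq.trans (to (entries≡⇔ i j i j′) (C i (<-≤-trans i<m m≤n))) (InWindow-cong iK≡s refl))

  SameBlock : ℕ → ℕ → Set
  SameBlock j j′ = ∃ λ q → q < m × d * q ≤ j × suc j ≤ d * suc q × d * q ≤ j′ × suc j′ ≤ d * suc q

  sameBlock⇔ : ∀ {j j′} → j < n → j / d ≡ j′ / d ⇔ SameBlock j j′
  sameBlock⇔ {j} {j′} j<n = mk⇔
    (λ e → let (j≥ , j<) = to /≡⇔block refl ; (j′≥ , j′<) = to /≡⇔block (sym e)
           in j / d , m<n*o⇒m/o<n {j} {m} {d} (subst (j <_) n≡m*d j<n) , j≥ , j< , j′≥ , j′<)
    (λ { (q , _ , j≥ , j< , j′≥ , j′<) →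
           trans (from /≡⇔block (j≥ , j<)) (sym (from /≡⇔block (j′≥ , j′<))) })

proposition4p6 : (n' k : ℕ) → k ≤ suc n' →
    (∀ i j → i < suc n' → j < suc n' →
      RowsEq n' k i j ⇔ ModEq (nOverD (suc n') k) i j)
    ×
    (∀ i j → i < suc n' → j < suc n' →
      ColsEq n' k i j ⇔
        (∃ λ q → q < nOverD (suc n') k
          × gcd (suc n') k * q ≤ i × suc i ≤ gcd (suc n') k * suc q
          × gcd (suc n') k * q ≤ j × suc j ≤ gcd (suc n') k * suc q))
proposition4p6 n′ k k≤n = rows , cols
  where
  d m K : ℕ
  d = gcd (suc n′) k
  m = nOverD (suc n′) k
  K = quotient (gcd[m,n]∣n (suc n′) k)

  instance
    d≢0 : NonZero d
    d≢0 = ≢-nonZero (gcd[m,n]≢0 (suc n′) k (inj₁ λ ()))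
    m≢0 : NonZero m
    m≢0 = quotient≢0 (gcd[m,n]∣m (suc n′) k)

  m⊥K : Coprime m K
  m⊥K = subst₂ Coprime (n/m≡quotient (gcd[m,n]∣m (suc n′) k)) (n/m≡quotient (gcd[m,n]∣n (suc n′) k))
                       (coprime-/gcd (suc n′) k)

  open CyclicMatrix k≤n (_∣_.equality (gcd[m,n]∣m (suc n′) k)) (_∣_.equality (gcd[m,n]∣n (suc n′) k)) m⊥K

  -- (i) holds without the bounds i, i′ < n.
  rows : ∀ i i′ → i < n → i′ < n → RowsEq n′ k i i′ ⇔ ModEq m i i′
  rows i i′ _ _ = Eq.trans (rowsEq⇔ i i′)
    (Eq.trans (mk⇔ (*-cancelʳ-% m⊥K i i′) (λ e → %-cong-* {m} e refl)) %≡%⇔ModEq)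

  cols : ∀ j j′ → j < n → j′ < n → ColsEq n′ k j j′ ⇔ SameBlock j j′
  cols j j′ j<n j′<n = Eq.trans (colsEq⇔ j j′ j<n j′<n) (sameBlock⇔ j<n)
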